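{- Let $\Gamma$ be a finite abelian group and let $x\in\Gamma(3)$ have order $k=3^tm$ with $m\not\equiv0\pmod3$ and $t\ge2$. Then for each $\alpha\in\Gamma$, $$T_x(\alpha)=\begin{cases}3\sqrt3\, i\sum_{r\in G^1_{3^{t-1}m,3}(1)}\big(\psi_\alpha(x^r)-\psi_\alpha(-x^r)\big) & \text{if }\psi_\alpha(x^{k/3})=1,\\ 0&\text{otherwise.}\end{cases}$$
   Context: $\Gamma$ is written additively as $\mathbb{Z}_{n_1}\times\cdots\times\mathbb{Z}_{n_k}$, and $x^r$ denotes $rx$. The character is $\psi_\alpha(x)=\prod_j\exp(2\pi i\alpha_jx_j/n_j)$. For $q\equiv0\pmod3$, $G^1_{q,3}(1)=\{r:1\le r\le q-1,\ \gcd(r,q)=1,\ r\equiv1\pmod3\}$. $\Gamma(3)$ is the set of elements whose order is divisible by $3$. For $y\in\Gamma(3)$ with $\mathrm{ord}(y)=q$, put $\langle\!\langle y\rangle\!\rangle=\{y^r:r\in G^1_{q,3}(1)\}$, and $T_y(\alpha)=\sum_{s\in\langle\!\langle y\rangle\!\rangle}i\sqrt3\,(\psi_\alpha(s)-\psi_\alpha(-s))$. -}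

module Defs where

open import Level using (Level)
open import Algebra.Bundles using (CommutativeRing)
open import Data.Nat using (ℕ; zero; suc; _≤_; _<_; _∸_; NonZero)
  renaming (_+_ to _+ℕ_; _*_ to _*ℕ_)
open import Data.Nat.DivMod using (_/_; _%_; _mod_)
open import Data.Nat.GCD using (gcd)
open import Data.Fin using (Fin; toℕ) renaming (zero to fzero)
open import Data.Fin.Properties using (all?)
import Data.Fin.Properties as FinP
open import Data.List using (List; []; _∷_; map; filter; upTo; allFin; foldr; deduplicate)
open import Data.Product using (_×_)
open import Relation.Nullary.Decidable using (Dec; _×-dec_)
open import Relation.Binary.PropositionalEquality using (_≡_)
import Data.Nat.Properties as ℕP

G¹ : ℕ → List ℕ
G¹ q = filter (λ r → (gcd r q ℕP.≟ 1) ×-dec (r % 3 ℕP.≟ 1)) (map suc (upTo (q ∸ 1)))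

-- The finite abelian group Γ = ℤ_{n_1} × ⋯ × ℤ_{n_k}, with n_j = suc (m j) ≥ 1,
-- written additively; elements are tuples (x_j)_j with x_j ∈ Fin n_j.
module Group {k : ℕ} (m : Fin k → ℕ) where

  n : Fin k → ℕ
  n j = suc (m j)

  Γ : Set
  Γ = (j : Fin k) → Fin (n j)

  0Γ : Γ
  0Γ j = fzero

  -Γ_ : Γ → Γ
  -Γ_ x j = (n j ∸ toℕ (x j)) mod n j

  _^Γ_ : Γ → ℕ → Γ
  (x ^Γ r) j = (r *ℕ toℕ (x j)) mod n j

  _≈Γ_ : Γ → Γ → Set
  x ≈Γ y = ∀ j → x j ≡ y j

  _≟Γ_ : (x y : Γ) → Dec (x ≈Γ y)
  x ≟Γ y = all? (λ j → x j FinP.≟ y j)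

  HasOrder : Γ → ℕ → Set
  HasOrder x q = (0 < q) × ((x ^Γ q) ≈Γ 0Γ)
               × (∀ d → 0 < d → d < q → ¬' ((x ^Γ d) ≈Γ 0Γ))
    where
      open import Relation.Nullary using () renaming (¬_ to ¬'_)

  ⟪_⟫ : Γ → ℕ → List Γ
  ⟪ y ⟫ q = deduplicate _≟Γ_ (map (y ^Γ_) (G¹ q))

powR : ∀ {c ℓ} (R : CommutativeRing c ℓ) → CommutativeRing.Carrier R → ℕ → CommutativeRing.Carrier R
powR R a zero = CommutativeRing.1# R
powR R a (suc e) = CommutativeRing._*_ R a (powR R a e)

-- Values of characters: we work in a commutative ring R (an integral domain of
-- characteristic 0) containing a primitive L-th root of unity ζ, where every n_j
-- and 3 divide L.  Then exp(2πi a / n_j) is represented by ζ^(a · (L / n_j)),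
-- and i√3 = ω - ω² with ω = exp(2πi/3) = ζ^(L/3).
module Chars {c ℓ : Level} (R : CommutativeRing c ℓ) (ζ : CommutativeRing.Carrier R)
             (L : ℕ) {k : ℕ} (m : Fin k → ℕ) where

  open CommutativeRing R
  open Group m
  infixr 8 _^R_

  _^R_ : Carrier → ℕ → Carrier
  _^R_ = powR R

  ΣR : List Carrier → Carrier
  ΣR = foldr _+_ 0#

  ΠR : List Carrier → Carrier
  ΠR = foldr _*_ 1#

  ψ : Γ → Γ → Carrier
  ψ α x = ΠR (map (λ j → ζ ^R (toℕ (α j) *ℕ toℕ (x j) *ℕ (L / n j))) (allFin k))

  i√3 : Carrier
  i√3 = ζ ^R (L / 3) - ζ ^R (2 *ℕ (L / 3))

  T : Γ → ℕ → Γ → Carrier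
  T y q α = ΣR (map (λ s → i√3 * (ψ α s - ψ α (-Γ s))) (⟪ y ⟫ q))

ℕ→R : ∀ {c ℓ} (R : CommutativeRing c ℓ) → ℕ → CommutativeRing.Carrier R
ℕ→R R zero = CommutativeRing.0# R
ℕ→R R (suc n) = CommutativeRing._+_ R (CommutativeRing.1# R) (ℕ→R R n)

-- Write the order of x as 3K with 3 ∣ K. The elements of G¹_{3K} are then exactly r, K + r and 2K + r
-- for r ∈ G¹_K: being coprime to 3K or to K is the same, and adding K changes neither the gcd with K
-- nor the residue mod 3. The x^r are pairwise distinct for r below the order of x, so T_x(α) is a plain
-- sum over G¹_{3K}. With c = ψ_α(x), the two halves of each term are c^r and (c⁻¹)^r, so each half
-- factors as Φ₃(u) = 1 + u + u², resp. Φ₃(u⁻¹), times the corresponding sum over G¹_K, where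
-- u = c^K = ψ_α(x^K) satisfies u³ = ψ_α(x^{3K}) = 1; hence Φ₃(u⁻¹) = Φ₃(u²) = Φ₃(u). Finally Φ₃(u) is
-- 3 if u = 1, and 0 otherwise, because (u − 1) Φ₃(u) = u³ − 1 = 0 in a ring without zero divisors.

module Submission where

open import Defs
open import Level using (Level; 0ℓ)
open import Algebra.Bundles using (CommutativeRing)
open import Data.Nat using (ℕ; zero; suc; _<_; _≤_; z≤n; s≤s; NonZero)
open import Data.Nat.Divisibility using (_∣_; divides; ∣-trans; m∣m*n; n∣m*n; ∣m∣n⇒∣m+n)
open import Data.Nat.DivMod using (_/_; _%_; m≡m%n+[m/n]*n; m*n%n≡0; m*[n/m]≡n; m*n/n≡m; [m+kn]%n≡m%n)
open import Data.Nat.GCD using (gcd)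
open import Data.Nat.Coprimality using (Coprime; gcd≡1⇒coprime; coprime⇒gcd≡1; coprime-+; coprime-divisor)
import Data.Nat.Properties as ℕP
open import Data.Fin using (Fin; toℕ)
import Data.Fin.Properties as FinP
open import Data.List using (List; []; _∷_; _++_; map; filter; upTo; applyUpTo; allFin; foldr; deduplicate)
import Data.List.Properties as LP
open import Data.List.Relation.Unary.AllPairs using (AllPairs; []; _∷_)
import Data.List.Relation.Unary.AllPairs as AllPairs
import Data.List.Relation.Unary.AllPairs.Properties as AllPairsP
open import Data.Product using (_×_; _,_; proj₁; proj₂)
open import Data.Sum using (_⊎_; [_,_]′)
open import Function using (_∘_; id)
open import Relation.Nullary using (¬_; yes; no; ¬?; contradiction)
open import Relation.Nullary.Decidable using (_×-dec_)
open import Relation.Unary using (Pred; Decidable; _≐_)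
open import Relation.Binary.Core using (Rel)
import Relation.Binary.Definitions as B
open import Relation.Binary.PropositionalEquality using (_≡_)
import Relation.Binary.PropositionalEquality as ≡

module ListFacts where
  open ≡ using (refl; sym; trans; cong)
  open import Data.Nat using (_+_)

  filter-map : ∀ {a b p q} {A : Set a} {B : Set b} {P : Pred B p} {Q : Pred A q}
               (P? : Decidable P) (Q? : Decidable Q) (f : A → B) → (P ∘ f) ≐ Q →
               ∀ xs → filter P? (map f xs) ≡ map f (filter Q? xs)
  filter-map P? Q? f P∘f≐Q [] = refl
  filter-map P? Q? f P∘f≐Q (x ∷ xs) with Q? x
  ... | yes qx = trans (LP.filter-accept P? (proj₂ P∘f≐Q qx)) (cong (f x ∷_) (filter-map P? Q? f P∘f≐Q xs))
  ... | no ¬qx = trans (LP.filter-reject P? (¬qx ∘ proj₁ P∘f≐Q)) (filter-map P? Q? f P∘f≐Q xs)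

  deduplicate-distinct : ∀ {a r} {A : Set a} {R : Rel A r} (R? : B.Decidable R) {xs} →
                         AllPairs (λ x y → ¬ R x y) xs → deduplicate R? xs ≡ xs
  deduplicate-distinct R? [] = refl
  deduplicate-distinct R? {x ∷ xs} (x≉xs ∷ xs!) = cong (x ∷_) (begin
      filter (¬? ∘ R? x) (deduplicate R? xs) ≡⟨ cong (filter (¬? ∘ R? x)) (deduplicate-distinct R? xs!) ⟩
      filter (¬? ∘ R? x) xs                  ≡⟨ LP.filter-all (¬? ∘ R? x) x≉xs ⟩
      xs                                     ∎)
    where open ≡.≡-Reasoning

  applyUpTo-+ : ∀ {a} {A : Set a} (f : ℕ → A) m n →
                applyUpTo f (m + n) ≡ applyUpTo f m ++ applyUpTo (f ∘ (m +_)) n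
  applyUpTo-+ f zero    n = refl
  applyUpTo-+ f (suc m) n = cong (f 0 ∷_) (applyUpTo-+ (f ∘ suc) m n)

  upTo-+ : ∀ m n → upTo (m + n) ≡ upTo m ++ map (m +_) (upTo n)
  upTo-+ m n = trans (applyUpTo-+ id m n) (cong (upTo m ++_) (sym (LP.map-upTo (m +_) n)))

module G¹Facts where
  open ≡ using (refl; sym; trans; cong)
  open import Data.Nat using (_+_; _*_)
  open ListFacts

  IsG¹ : ℕ → Pred ℕ 0ℓ
  IsG¹ q r = gcd r q ≡ 1 × r % 3 ≡ 1

  isG¹? : ∀ q → Decidable (IsG¹ q)
  isG¹? q r = (gcd r q ℕP.≟ 1) ×-dec (r % 3 ℕP.≟ 1)

  G¹≡filter-upTo : ∀ q → G¹ q ≡ filter (isG¹? q) (upTo q)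
  G¹≡filter-upTo zero    = refl
  G¹≡filter-upTo (suc q) = sym (trans (LP.filter-reject (isG¹? (suc q)) {0} (λ ()))
                                      (cong (filter (isG¹? (suc q))) (sym (LP.map-upTo suc q))))

  G¹-increasing : ∀ q → AllPairs (λ a b → a < b × b < q) (G¹ q)
  G¹-increasing q = ≡.subst (AllPairs _) (sym (G¹≡filter-upTo q))
    (AllPairsP.filter⁺ (isG¹? q) (AllPairsP.applyUpTo⁺₁ id q _,_))

  coprime-*⇒ : ∀ d {r K} → Coprime r (d * K) → Coprime r K
  coprime-*⇒ d r⊥dK (e∣r , e∣K) = r⊥dK (e∣r , ∣-trans e∣K (n∣m*n d))

  coprime-*⇐ : ∀ {d r K} → d ∣ K → Coprime r K → Coprime r (d * K)
  coprime-*⇐ {d} {r} d∣K r⊥K {e} (e∣r , e∣dK) = r⊥K (e∣r , coprime-divisor e⊥d e∣dK)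
    where
      e⊥d : Coprime e d
      e⊥d (f∣e , f∣d) = r⊥K (∣-trans f∣e e∣r , ∣-trans f∣d d∣K)

  IsG¹-3*≐ : ∀ {K} → 3 ∣ K → IsG¹ (3 * K) ≐ IsG¹ K
  IsG¹-3*≐ {K} 3∣K =
      (λ {r} (r⊥3K , r≡1) → coprime⇒gcd≡1 (coprime-*⇒ 3 (gcd≡1⇒coprime {r} r⊥3K)) , r≡1)
    , (λ {r} (r⊥K , r≡1) → coprime⇒gcd≡1 (coprime-*⇐ 3∣K (gcd≡1⇒coprime {r} {K} r⊥K)) , r≡1)

  +-%3 : ∀ {K} r → 3 ∣ K → (K + r) % 3 ≡ r % 3
  +-%3 r (divides q refl) = trans (cong (_% 3) (ℕP.+-comm (q * 3) r)) ([m+kn]%n≡m%n r q 3)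

  IsG¹-+≐ : ∀ {K} → 3 ∣ K → (IsG¹ K ∘ (K +_)) ≐ IsG¹ K
  IsG¹-+≐ {K} 3∣K =
      (λ {r} (K+r⊥K , K+r≡1) → coprime⇒gcd≡1 (unshift (gcd≡1⇒coprime {K + r} {K} K+r⊥K))
                              , trans (sym (+-%3 r 3∣K)) K+r≡1)
    , (λ {r} (r⊥K , r≡1) → coprime⇒gcd≡1 (coprime-+ (gcd≡1⇒coprime {r} {K} r⊥K))
                          , trans (+-%3 r 3∣K) r≡1)
    where
      unshift : ∀ {r} → Coprime (K + r) K → Coprime r K
      unshift K+r⊥K (e∣r , e∣K) = K+r⊥K (∣m∣n⇒∣m+n e∣K e∣r , e∣K)

  upTo-3* : ∀ K → upTo (3 * K) ≡ upTo K ++ map (K +_) (upTo K ++ map (K +_) (upTo K))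
  upTo-3* K = begin
    upTo (3 * K)                          ≡⟨ cong (λ z → upTo (K + (K + z))) (ℕP.+-identityʳ K) ⟩
    upTo (K + (K + K))                    ≡⟨ upTo-+ K (K + K) ⟩
    upTo K ++ map (K +_) (upTo (K + K))   ≡⟨ cong (λ l → upTo K ++ map (K +_) l) (upTo-+ K K) ⟩
    upTo K ++ map (K +_) (upTo K ++ map (K +_) (upTo K)) ∎
    where open ≡.≡-Reasoning

  G¹-3* : ∀ {K} → 3 ∣ K → G¹ (3 * K) ≡ G¹ K ++ map (K +_) (G¹ K ++ map (K +_) (G¹ K))
  G¹-3* {K} 3∣K = begin
    G¹ (3 * K)                                                     ≡⟨ G¹≡filter-upTo (3 * K) ⟩
    filter (isG¹? (3 * K)) (upTo (3 * K))                          ≡⟨ LP.filter-≐ (isG¹? (3 * K)) P? (IsG¹-3*≐ 3∣K) (upTo (3 * K)) ⟩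
    filter P? (upTo (3 * K))                                       ≡⟨ cong (filter P?) (upTo-3* K) ⟩
    filter P? (upTo K ++ map (K +_) (upTo K ++ map (K +_) (upTo K))) ≡⟨ filter-shift _ ⟩
    G¹ K ++ map (K +_) (filter P? (upTo K ++ map (K +_) (upTo K))) ≡⟨ cong (λ l → G¹ K ++ map (K +_) l) (filter-shift _) ⟩
    G¹ K ++ map (K +_) (G¹ K ++ map (K +_) (filter P? (upTo K)))   ≡⟨ cong (λ l → G¹ K ++ map (K +_) (G¹ K ++ map (K +_) l)) (sym (G¹≡filter-upTo K)) ⟩
    G¹ K ++ map (K +_) (G¹ K ++ map (K +_) (G¹ K))                 ∎
    where
      open ≡.≡-Reasoning
      P? : Decidable (IsG¹ K)
      P? = isG¹? K
      filter-shift : ∀ ys → filter P? (upTo K ++ map (K +_) ys) ≡ G¹ K ++ map (K +_) (filter P? ys)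
      filter-shift ys = trans (LP.filter-++ P? (upTo K) _)
        (≡.cong₂ _++_ (sym (G¹≡filter-upTo K)) (filter-map P? P? (K +_) (IsG¹-+≐ 3∣K) ys))


module MultiplesInΓ {k} (m : Fin k → ℕ) where
  open ≡ using (sym; trans; cong)
  open import Data.Nat using (_+_; _*_; _∸_)
  open Group m

  %-≡⇒∸%≡0 : ∀ a b N .{{_ : NonZero N}} → a % N ≡ b % N → (a ∸ b) % N ≡ 0
  %-≡⇒∸%≡0 a b N a≡b = trans (cong (_% N) a∸b≡) (m*n%n≡0 (a / N ∸ b / N) N)
    where
      open ≡.≡-Reasoning
      a∸b≡ : a ∸ b ≡ (a / N ∸ b / N) * N
      a∸b≡ = begin
        a ∸ b                                          ≡⟨ ≡.cong₂ _∸_ (m≡m%n+[m/n]*n a N) (m≡m%n+[m/n]*n b N) ⟩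
        (a % N + a / N * N) ∸ (b % N + b / N * N)      ≡⟨ cong (λ z → (z + a / N * N) ∸ (b % N + b / N * N)) a≡b ⟩
        (b % N + a / N * N) ∸ (b % N + b / N * N)      ≡⟨ ℕP.[m+n]∸[m+o]≡n∸o (b % N) _ _ ⟩
        a / N * N ∸ b / N * N                          ≡⟨ ℕP.*-distribʳ-∸ N (a / N) (b / N) ⟨
        (a / N ∸ b / N) * N                            ∎

  toℕ-^Γ : ∀ x r j → toℕ ((x ^Γ r) j) ≡ r * toℕ (x j) % n j
  toℕ-^Γ x r j = FinP.toℕ-fromℕ< _

  ^Γ-injective : ∀ {x q} → HasOrder x q → ∀ {a b} → a < b → b < q → ¬ ((x ^Γ a) ≈Γ (x ^Γ b))
  ^Γ-injective {x} (_ , _ , minimal) {a} {b} a<b b<q xᵃ≈xᵇ =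
    minimal (b ∸ a) (ℕP.m<n⇒0<n∸m a<b) (ℕP.≤-<-trans (ℕP.m∸n≤m b a) b<q) xᵇ⁻ᵃ≈0
    where
      xᵇ⁻ᵃ≈0 : (x ^Γ (b ∸ a)) ≈Γ 0Γ
      xᵇ⁻ᵃ≈0 j = FinP.toℕ-injective (begin
        toℕ ((x ^Γ (b ∸ a)) j)            ≡⟨ toℕ-^Γ x (b ∸ a) j ⟩
        (b ∸ a) * toℕ (x j) % n j         ≡⟨ cong (_% n j) (ℕP.*-distribʳ-∸ (toℕ (x j)) b a) ⟩
        (b * toℕ (x j) ∸ a * toℕ (x j)) % n j ≡⟨ %-≡⇒∸%≡0 (b * toℕ (x j)) (a * toℕ (x j)) (n j) (trans (sym (toℕ-^Γ x b j))
                                                   (trans (cong toℕ (sym (xᵃ≈xᵇ j))) (toℕ-^Γ x a j))) ⟩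
        0                                 ∎)
        where open ≡.≡-Reasoning

  ⟪⟫≡map : ∀ {x q} → HasOrder x q → ⟪ x ⟫ q ≡ map (x ^Γ_) (G¹ q)
  ⟪⟫≡map {x} {q} hasOrder = ListFacts.deduplicate-distinct _≟Γ_
    (AllPairsP.map⁺ (AllPairs.map (λ (a<b , b<q) → ^Γ-injective hasOrder a<b b<q) (G¹Facts.G¹-increasing q)))

module CommutativeRingFacts {c ℓ} (R : CommutativeRing c ℓ) where
  open CommutativeRing R
  open import Data.Nat using () renaming (_+_ to _+ℕ_; _*_ to _*ℕ_)
  open import Algebra.Properties.Ring ring using (-‿+-comm; [y-z]x≈yx-zx; x∙y⁻¹≈ε⇒x≈y)
  open import Algebra.Properties.CommutativeSemigroup +-commutativeSemigroup using () renaming (interchange to +-interchange)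
  open import Algebra.Properties.CommutativeSemigroup *-commutativeSemigroup using () renaming (interchange to *-interchange)
  open import Algebra.Properties.Semiring.Exp semiring public using (_^_; ^-congˡ; ^-homo-*; ^-assocʳ)
  open import Algebra.Properties.CommutativeSemiring.Exp commutativeSemiring public using (^-distrib-*)
  open import Algebra.Solver.Ring.NaturalCoefficients.Default commutativeSemiring using (solve; _:+_; _:*_; _:=_; con)
  open import Relation.Binary.Reasoning.Setoid setoid
  open G¹Facts using (G¹-3*)

  powR≡^ : ∀ a n → powR R a n ≡ a ^ n
  powR≡^ a zero    = ≡.refl
  powR≡^ a (suc n) = ≡.cong (a *_) (powR≡^ a n)

  1^n≈1 : ∀ n → 1# ^ n ≈ 1#
  1^n≈1 zero    = refl
  1^n≈1 (suc n) = trans (*-identityˡ _) (1^n≈1 n)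

  ^-*-period : ∀ {ζ L} → ζ ^ L ≈ 1# → ∀ q → ζ ^ (q *ℕ L) ≈ 1#
  ^-*-period {ζ} {L} ζ^L≈1 q = begin
    ζ ^ (q *ℕ L)  ≡⟨ ≡.cong (ζ ^_) (ℕP.*-comm q L) ⟩
    ζ ^ (L *ℕ q)  ≈⟨ ^-assocʳ ζ L q ⟨
    (ζ ^ L) ^ q   ≈⟨ ^-congˡ q ζ^L≈1 ⟩
    1# ^ q        ≈⟨ 1^n≈1 q ⟩
    1#            ∎

  ^-+-period : ∀ {ζ L} → ζ ^ L ≈ 1# → ∀ a q → ζ ^ (a +ℕ q *ℕ L) ≈ ζ ^ a
  ^-+-period {ζ} ζ^L≈1 a q = begin
    ζ ^ (a +ℕ q *ℕ _)     ≈⟨ ^-homo-* ζ a _ ⟩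
    ζ ^ a * ζ ^ (q *ℕ _)  ≈⟨ *-congˡ (^-*-period ζ^L≈1 q) ⟩
    ζ ^ a * 1#            ≈⟨ *-identityʳ _ ⟩
    ζ ^ a                 ∎

  inverse-unique : ∀ {a b y} → a * y ≈ 1# → b * y ≈ 1# → a ≈ b
  inverse-unique {a} {b} {y} ay≈1 by≈1 = begin
    a             ≈⟨ *-identityʳ a ⟨
    a * 1#        ≈⟨ *-congˡ by≈1 ⟨
    a * (b * y)   ≈⟨ *-congˡ (*-comm b y) ⟩
    a * (y * b)   ≈⟨ *-assoc a y b ⟨
    (a * y) * b   ≈⟨ *-congʳ ay≈1 ⟩
    1# * b        ≈⟨ *-identityˡ b ⟩
    b             ∎

  ∑ : List Carrier → Carrier
  ∑ = foldr _+_ 0#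

  ∏ : List Carrier → Carrier
  ∏ = foldr _*_ 1#

  ∑-++ : ∀ xs ys → ∑ (xs ++ ys) ≈ ∑ xs + ∑ ys
  ∑-++ []       ys = sym (+-identityˡ _)
  ∑-++ (x ∷ xs) ys = trans (+-congˡ (∑-++ xs ys)) (sym (+-assoc _ _ _))

  *-distribˡ-∑ : ∀ a xs → a * ∑ xs ≈ ∑ (map (a *_) xs)
  *-distribˡ-∑ a []       = zeroʳ a
  *-distribˡ-∑ a (x ∷ xs) = trans (distribˡ a x _) (+-congˡ (*-distribˡ-∑ a xs))

  module _ {a} {A : Set a} where
    ∑-cong : ∀ {f g : A → Carrier} → (∀ z → f z ≈ g z) → ∀ xs → ∑ (map f xs) ≈ ∑ (map g xs)
    ∑-cong f≈g []       = refl
    ∑-cong f≈g (x ∷ xs) = +-cong (f≈g x) (∑-cong f≈g xs)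

    ∑-sub : ∀ (f g : A → Carrier) xs → ∑ (map (λ z → f z - g z) xs) ≈ ∑ (map f xs) - ∑ (map g xs)
    ∑-sub f g []       = sym (-‿inverseʳ 0#)
    ∑-sub f g (x ∷ xs) = begin
      (f x - g x) + ∑ (map (λ z → f z - g z) xs)              ≈⟨ +-congˡ (∑-sub f g xs) ⟩
      (f x - g x) + (∑ (map f xs) - ∑ (map g xs))            ≈⟨ +-interchange _ _ _ _ ⟩
      (f x + ∑ (map f xs)) + (- g x + - ∑ (map g xs))        ≈⟨ +-congˡ (-‿+-comm _ _) ⟩
      (f x + ∑ (map f xs)) - (g x + ∑ (map g xs))            ∎

    ∏-cong : ∀ {f g : A → Carrier} → (∀ z → f z ≈ g z) → ∀ xs → ∏ (map f xs) ≈ ∏ (map g xs)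
    ∏-cong f≈g []       = refl
    ∏-cong f≈g (x ∷ xs) = *-cong (f≈g x) (∏-cong f≈g xs)

    ∏-* : ∀ (f g : A → Carrier) xs → ∏ (map f xs) * ∏ (map g xs) ≈ ∏ (map (λ z → f z * g z) xs)
    ∏-* f g []       = *-identityˡ 1#
    ∏-* f g (x ∷ xs) = trans (*-interchange _ _ _ _) (*-congˡ (∏-* f g xs))

    ∏-^ : ∀ (f : A → Carrier) r xs → ∏ (map (λ z → f z ^ r) xs) ≈ ∏ (map f xs) ^ r
    ∏-^ f r []       = sym (1^n≈1 r)
    ∏-^ f r (x ∷ xs) = trans (*-congˡ (∏-^ f r xs)) (sym (^-distrib-* (f x) _ r))

    ∏-1 : ∀ {f : A → Carrier} → (∀ z → f z ≈ 1#) → ∀ xs → ∏ (map f xs) ≈ 1#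
    ∏-1 f≈1 []       = refl
    ∏-1 f≈1 (x ∷ xs) = trans (*-cong (f≈1 x) (∏-1 f≈1 xs)) (*-identityˡ 1#)

  Φ₃ : Carrier → Carrier
  Φ₃ u = 1# + u + u * u

  ^3-expand : ∀ u → u ^ 3 ≈ u * (u * u)
  ^3-expand u = *-congˡ (*-congˡ (*-identityʳ u))

  Φ₃≈3 : ∀ {u} → u ≈ 1# → Φ₃ u ≈ ℕ→R R 3
  Φ₃≈3 {u} u≈1 = begin
    1# + u + u * u        ≈⟨ +-cong (+-congˡ u≈1) (trans (*-cong u≈1 u≈1) (*-identityˡ 1#)) ⟩
    1# + 1# + 1#          ≈⟨ +-assoc 1# 1# 1# ⟩
    1# + (1# + 1#)        ≈⟨ +-congˡ (+-congˡ (+-identityʳ 1#)) ⟨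
    1# + (1# + (1# + 0#)) ∎

  Φ₃≈0 : (∀ a b → a * b ≈ 0# → a ≈ 0# ⊎ b ≈ 0#) →
         ∀ {u} → u ^ 3 ≈ 1# → ¬ u ≈ 1# → Φ₃ u ≈ 0#
  Φ₃≈0 noZeroDivisors {u} u³≈1 u≉1 =
    [ (λ u-1≈0 → contradiction (x∙y⁻¹≈ε⇒x≈y u 1# u-1≈0) u≉1) , id ]′ (noZeroDivisors (u - 1#) (Φ₃ u) [u-1]Φ₃≈0)
    where
      uΦ₃≈Φ₃ : u * Φ₃ u ≈ Φ₃ u
      uΦ₃≈Φ₃ = begin
        u * (1# + u + u * u)        ≈⟨ solve 1 (λ u → u :* (con 1 :+ u :+ u :* u) := u :+ u :* u :+ u :* (u :* u)) refl u ⟩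
        u + u * u + u * (u * u)     ≈⟨ +-congˡ (trans (sym (^3-expand u)) u³≈1) ⟩
        u + u * u + 1#              ≈⟨ solve 1 (λ u → u :+ u :* u :+ con 1 := con 1 :+ u :+ u :* u) refl u ⟩
        1# + u + u * u              ∎
      [u-1]Φ₃≈0 : (u - 1#) * Φ₃ u ≈ 0#
      [u-1]Φ₃≈0 = begin
        (u - 1#) * Φ₃ u           ≈⟨ [y-z]x≈yx-zx (Φ₃ u) u 1# ⟩
        u * Φ₃ u - 1# * Φ₃ u      ≈⟨ +-cong uΦ₃≈Φ₃ (-‿cong (*-identityˡ _)) ⟩
        Φ₃ u - Φ₃ u               ≈⟨ -‿inverseʳ _ ⟩
        0#                        ∎

  Φ₃-inverse : ∀ {u v} → u ^ 3 ≈ 1# → v * u ≈ 1# → Φ₃ v ≈ Φ₃ u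
  Φ₃-inverse {u} {v} u³≈1 vu≈1 = begin
    1# + v + v * v                  ≈⟨ +-cong (+-congˡ v≈u²) (*-cong v≈u² v≈u²) ⟩
    1# + u * u + (u * u) * (u * u)  ≈⟨ +-congˡ u⁴≈u ⟩
    1# + u * u + u                  ≈⟨ solve 1 (λ u → con 1 :+ u :* u :+ u := con 1 :+ u :+ u :* u) refl u ⟩
    1# + u + u * u                  ∎
    where
      v≈u² : v ≈ u * u
      v≈u² = begin
        v                  ≈⟨ *-identityʳ v ⟨
        v * 1#             ≈⟨ *-congˡ (trans (sym (^3-expand u)) u³≈1) ⟨
        v * (u * (u * u))  ≈⟨ *-assoc v u _ ⟨
        (v * u) * (u * u)  ≈⟨ *-congʳ vu≈1 ⟩
        1# * (u * u)       ≈⟨ *-identityˡ _ ⟩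
        u * u              ∎
      u⁴≈u : (u * u) * (u * u) ≈ u
      u⁴≈u = begin
        (u * u) * (u * u)  ≈⟨ solve 1 (λ u → (u :* u) :* (u :* u) := u :* (u :* (u :* u))) refl u ⟩
        u * (u * (u * u))  ≈⟨ *-congˡ (trans (sym (^3-expand u)) u³≈1) ⟩
        u * 1#             ≈⟨ *-identityʳ u ⟩
        u                  ∎

  ∑-^-++-shift : ∀ w K xs ys → ∑ (map (w ^_) (xs ++ map (K +ℕ_) ys)) ≈ ∑ (map (w ^_) xs) + w ^ K * ∑ (map (w ^_) ys)
  ∑-^-++-shift w K xs ys = begin
    ∑ (map (w ^_) (xs ++ map (K +ℕ_) ys))                      ≡⟨ ≡.cong ∑ (LP.map-++ (w ^_) xs _) ⟩
    ∑ (map (w ^_) xs ++ map (w ^_) (map (K +ℕ_) ys))           ≈⟨ ∑-++ (map (w ^_) xs) _ ⟩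
    ∑ (map (w ^_) xs) + ∑ (map (w ^_) (map (K +ℕ_) ys))        ≡⟨ ≡.cong (λ l → ∑ (map (w ^_) xs) + ∑ l) (≡.sym (LP.map-∘ ys)) ⟩
    ∑ (map (w ^_) xs) + ∑ (map (λ r → w ^ (K +ℕ r)) ys)        ≈⟨ +-congˡ (∑-cong (^-homo-* w K) ys) ⟩
    ∑ (map (w ^_) xs) + ∑ (map (λ r → w ^ K * w ^ r) ys)       ≡⟨ ≡.cong (λ l → ∑ (map (w ^_) xs) + ∑ l) (LP.map-∘ ys) ⟩
    ∑ (map (w ^_) xs) + ∑ (map (w ^ K *_) (map (w ^_) ys))     ≈⟨ +-congˡ (*-distribˡ-∑ (w ^ K) (map (w ^_) ys)) ⟨
    ∑ (map (w ^_) xs) + w ^ K * ∑ (map (w ^_) ys)              ∎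

  ∑-^-G¹-3* : ∀ {K} → 3 ∣ K → ∀ w → ∑ (map (w ^_) (G¹ (3 *ℕ K))) ≈ Φ₃ (w ^ K) * ∑ (map (w ^_) (G¹ K))
  ∑-^-G¹-3* {K} 3∣K w = begin
    ∑ (map (w ^_) (G¹ (3 *ℕ K)))                              ≡⟨ ≡.cong (∑ ∘ map (w ^_)) (G¹-3* 3∣K) ⟩
    ∑ (map (w ^_) (G¹ K ++ map (K +ℕ_) (G¹ K ++ map (K +ℕ_) (G¹ K)))) ≈⟨ ∑-^-++-shift w K (G¹ K) _ ⟩
    S + w ^ K * ∑ (map (w ^_) (G¹ K ++ map (K +ℕ_) (G¹ K)))   ≈⟨ +-congˡ (*-congˡ (∑-^-++-shift w K (G¹ K) (G¹ K))) ⟩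
    S + w ^ K * (S + w ^ K * S)                               ≈⟨ solve 2 (λ S u → S :+ u :* (S :+ u :* S) := (con 1 :+ u :+ u :* u) :* S) refl S (w ^ K) ⟩
    Φ₃ (w ^ K) * S                                            ∎
    where
      S : Carrier
      S = ∑ (map (w ^_) (G¹ K))

module Characters {ℓ₁ ℓ₂} (R : CommutativeRing ℓ₁ ℓ₂) where
  open CommutativeRing R
  open CommutativeRingFacts R
  open import Data.Nat using () renaming (_+_ to _+ℕ_; _*_ to _*ℕ_; _∸_ to _∸ℕ_)
  open import Data.Nat.Tactic.RingSolver using (solve-∀)
  open import Algebra.Properties.Ring ring using (x[y-z]≈xy-xz)
  open import Relation.Binary.Reasoning.Setoid setoid

  module _ (ζ : Carrier) (L : ℕ) (ζ^L≈1 : powR R ζ L ≈ 1#)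
           {k} (m : Fin k → ℕ) (n∣L : ∀ j → Group.n m j ∣ L) where
    open Group m
    open MultiplesInΓ m
    open Chars R ζ L m using (ψ; T; i√3)

    ζᴸ≈1 : ζ ^ L ≈ 1#
    ζᴸ≈1 = trans (reflexive (≡.sym (powR≡^ ζ L))) ζ^L≈1

    Q : Fin k → ℕ
    Q j = L / n j

    ψⱼ : Γ → Γ → Fin k → Carrier
    ψⱼ α y j = ζ ^ (toℕ (α j) *ℕ toℕ (y j) *ℕ Q j)

    ψ≡∏ : ∀ α y → ψ α y ≡ ∏ (map (ψⱼ α y) (allFin k))
    ψ≡∏ α y = ≡.cong ∏ (LP.map-cong (λ j → powR≡^ ζ (toℕ (α j) *ℕ toℕ (y j) *ℕ Q j)) (allFin k))

    ζ^-mod : ∀ j a b → ζ ^ (a *ℕ (b % n j) *ℕ Q j) ≈ ζ ^ (a *ℕ b *ℕ Q j)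
    ζ^-mod j a b = sym (begin
      ζ ^ (a *ℕ b *ℕ Q j)                                    ≡⟨ ≡.cong (λ z → ζ ^ (a *ℕ z *ℕ Q j)) (m≡m%n+[m/n]*n b (n j)) ⟩
      ζ ^ (a *ℕ (b % n j +ℕ b / n j *ℕ n j) *ℕ Q j)          ≡⟨ ≡.cong (ζ ^_) (expand a (b % n j) (b / n j) (n j) (Q j)) ⟩
      ζ ^ (a *ℕ (b % n j) *ℕ Q j +ℕ a *ℕ (b / n j) *ℕ (n j *ℕ Q j)) ≡⟨ ≡.cong (λ z → ζ ^ (a *ℕ (b % n j) *ℕ Q j +ℕ a *ℕ (b / n j) *ℕ z)) (m*[n/m]≡n (n∣L j)) ⟩
      ζ ^ (a *ℕ (b % n j) *ℕ Q j +ℕ a *ℕ (b / n j) *ℕ L)     ≈⟨ ^-+-period ζᴸ≈1 (a *ℕ (b % n j) *ℕ Q j) (a *ℕ (b / n j)) ⟩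
      ζ ^ (a *ℕ (b % n j) *ℕ Q j)                            ∎)
      where
        expand : ∀ a r d N Q → a *ℕ (r +ℕ d *ℕ N) *ℕ Q ≡ a *ℕ r *ℕ Q +ℕ a *ℕ d *ℕ (N *ℕ Q)
        expand = solve-∀

    ψ-^Γ : ∀ α y r → ψ α (y ^Γ r) ≈ ψ α y ^ r
    ψ-^Γ α y r = begin
      ψ α (y ^Γ r)                               ≡⟨ ψ≡∏ α (y ^Γ r) ⟩
      ∏ (map (ψⱼ α (y ^Γ r)) (allFin k))         ≈⟨ ∏-cong component (allFin k) ⟩
      ∏ (map (λ j → ψⱼ α y j ^ r) (allFin k))    ≈⟨ ∏-^ (ψⱼ α y) r (allFin k) ⟩
      ∏ (map (ψⱼ α y) (allFin k)) ^ r            ≡⟨ ≡.cong (_^ r) (≡.sym (ψ≡∏ α y)) ⟩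
      ψ α y ^ r                                  ∎
      where
        commute : ∀ a r y Q → a *ℕ (r *ℕ y) *ℕ Q ≡ a *ℕ y *ℕ Q *ℕ r
        commute = solve-∀
        component : ∀ j → ψⱼ α (y ^Γ r) j ≈ ψⱼ α y j ^ r
        component j = let a = toℕ (α j) ; yⱼ = toℕ (y j) in begin
          ζ ^ (a *ℕ toℕ ((y ^Γ r) j) *ℕ Q j)   ≡⟨ ≡.cong (λ z → ζ ^ (a *ℕ z *ℕ Q j)) (toℕ-^Γ y r j) ⟩
          ζ ^ (a *ℕ (r *ℕ yⱼ % n j) *ℕ Q j)    ≈⟨ ζ^-mod j a (r *ℕ yⱼ) ⟩
          ζ ^ (a *ℕ (r *ℕ yⱼ) *ℕ Q j)          ≡⟨ ≡.cong (ζ ^_) (commute a r yⱼ (Q j)) ⟩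
          ζ ^ (a *ℕ yⱼ *ℕ Q j *ℕ r)            ≈⟨ ^-assocʳ ζ (a *ℕ yⱼ *ℕ Q j) r ⟨
          (ζ ^ (a *ℕ yⱼ *ℕ Q j)) ^ r           ∎

    ψ-inverse : ∀ α y → ψ α (-Γ y) * ψ α y ≈ 1#
    ψ-inverse α y = begin
      ψ α (-Γ y) * ψ α y                                             ≡⟨ ≡.cong₂ _*_ (ψ≡∏ α (-Γ y)) (ψ≡∏ α y) ⟩
      ∏ (map (ψⱼ α (-Γ y)) (allFin k)) * ∏ (map (ψⱼ α y) (allFin k)) ≈⟨ ∏-* (ψⱼ α (-Γ y)) (ψⱼ α y) (allFin k) ⟩
      ∏ (map (λ j → ψⱼ α (-Γ y) j * ψⱼ α y j) (allFin k))            ≈⟨ ∏-1 component (allFin k) ⟩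
      1#                                                             ∎
      where
        collect : ∀ a u y Q → a *ℕ u *ℕ Q +ℕ a *ℕ y *ℕ Q ≡ a *ℕ (u +ℕ y) *ℕ Q
        collect = solve-∀
        component : ∀ j → ψⱼ α (-Γ y) j * ψⱼ α y j ≈ 1#
        component j = let a = toℕ (α j) ; yⱼ = toℕ (y j) in begin
          ζ ^ (a *ℕ toℕ ((-Γ y) j) *ℕ Q j) * ζ ^ (a *ℕ yⱼ *ℕ Q j)  ≡⟨ ≡.cong (λ z → ζ ^ (a *ℕ z *ℕ Q j) * ζ ^ (a *ℕ yⱼ *ℕ Q j)) (FinP.toℕ-fromℕ< _) ⟩
          ζ ^ (a *ℕ ((n j ∸ℕ yⱼ) % n j) *ℕ Q j) * ζ ^ (a *ℕ yⱼ *ℕ Q j) ≈⟨ *-congʳ (ζ^-mod j a (n j ∸ℕ yⱼ)) ⟩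
          ζ ^ (a *ℕ (n j ∸ℕ yⱼ) *ℕ Q j) * ζ ^ (a *ℕ yⱼ *ℕ Q j)         ≈⟨ ^-homo-* ζ (a *ℕ (n j ∸ℕ yⱼ) *ℕ Q j) (a *ℕ yⱼ *ℕ Q j) ⟨
          ζ ^ (a *ℕ (n j ∸ℕ yⱼ) *ℕ Q j +ℕ a *ℕ yⱼ *ℕ Q j)              ≡⟨ ≡.cong (ζ ^_) (collect a (n j ∸ℕ yⱼ) yⱼ (Q j)) ⟩
          ζ ^ (a *ℕ (n j ∸ℕ yⱼ +ℕ yⱼ) *ℕ Q j)                         ≡⟨ ≡.cong (λ z → ζ ^ (a *ℕ z *ℕ Q j)) (ℕP.m∸n+n≡m (ℕP.<⇒≤ (FinP.toℕ<n (y j)))) ⟩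
          ζ ^ (a *ℕ n j *ℕ Q j)                                        ≡⟨ ≡.cong (ζ ^_) (≡.trans (ℕP.*-assoc a (n j) (Q j)) (≡.cong (a *ℕ_) (m*[n/m]≡n (n∣L j)))) ⟩
          ζ ^ (a *ℕ L)                                                 ≈⟨ ^-*-period ζᴸ≈1 a ⟩
          1#                                                           ∎

    ψ-0 : ∀ α y → y ≈Γ 0Γ → ψ α y ≈ 1#
    ψ-0 α y y≈0 = trans (reflexive (ψ≡∏ α y)) (∏-1 component (allFin k))
      where
        component : ∀ j → ψⱼ α y j ≈ 1#
        component j = reflexive (≡.cong (λ z → ζ ^ (z *ℕ Q j))
          (≡.trans (≡.cong (λ z → toℕ (α j) *ℕ toℕ z) (y≈0 j)) (ℕP.*-zeroʳ (toℕ (α j)))))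

    -- Both sides are inverses of ψ α (y ^Γ r), which avoids computing -(r y) = r (-y) in Γ.
    ψ-inverse-^Γ : ∀ α y r → ψ α (-Γ (y ^Γ r)) ≈ ψ α (-Γ y) ^ r
    ψ-inverse-^Γ α y r = inverse-unique (ψ-inverse α (y ^Γ r)) (begin
      ψ α (-Γ y) ^ r * ψ α (y ^Γ r)    ≈⟨ *-congˡ (ψ-^Γ α y r) ⟩
      ψ α (-Γ y) ^ r * ψ α y ^ r       ≈⟨ ^-distrib-* (ψ α (-Γ y)) (ψ α y) r ⟨
      (ψ α (-Γ y) * ψ α y) ^ r         ≈⟨ ^-congˡ r (ψ-inverse α y) ⟩
      1# ^ r                           ≈⟨ 1^n≈1 r ⟩
      1#                               ∎)

    χ : Γ → Γ → ℕ → Carrier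
    χ α x r = ψ α (x ^Γ r) - ψ α (-Γ (x ^Γ r))

    ∑χ≈ : ∀ α x rs → ∑ (map (χ α x) rs) ≈ ∑ (map (ψ α x ^_) rs) - ∑ (map (ψ α (-Γ x) ^_) rs)
    ∑χ≈ α x rs = trans (∑-cong (λ r → +-cong (ψ-^Γ α x r) (-‿cong (ψ-inverse-^Γ α x r))) rs)
                       (∑-sub (ψ α x ^_) (ψ α (-Γ x) ^_) rs)

    T≈i√3∑χ : ∀ {x q} → HasOrder x q → ∀ α → T x q α ≈ i√3 * ∑ (map (χ α x) (G¹ q))
    T≈i√3∑χ {x} {q} hasOrder α = begin
      T x q α                                  ≡⟨ ≡.cong (∑ ∘ map F) (⟪⟫≡map hasOrder) ⟩
      ∑ (map F (map (x ^Γ_) (G¹ q)))           ≡⟨ ≡.cong ∑ (≡.trans (≡.sym (LP.map-∘ (G¹ q))) (LP.map-∘ (G¹ q))) ⟩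
      ∑ (map (i√3 *_) (map (χ α x) (G¹ q)))    ≈⟨ *-distribˡ-∑ i√3 (map (χ α x) (G¹ q)) ⟨
      i√3 * ∑ (map (χ α x) (G¹ q))             ∎
      where
        F : Γ → Carrier
        F s = i√3 * (ψ α s - ψ α (-Γ s))

    ψ^K-cube≈1 : ∀ {x K} → HasOrder x (3 *ℕ K) → ∀ α → (ψ α x ^ K) ^ 3 ≈ 1#
    ψ^K-cube≈1 {x} {K} (_ , x^3K≈0 , _) α = begin
      (ψ α x ^ K) ^ 3        ≈⟨ ^-assocʳ (ψ α x) K 3 ⟩
      ψ α x ^ (K *ℕ 3)       ≡⟨ ≡.cong (ψ α x ^_) (ℕP.*-comm K 3) ⟩
      ψ α x ^ (3 *ℕ K)       ≈⟨ ψ-^Γ α x (3 *ℕ K) ⟨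
      ψ α (x ^Γ (3 *ℕ K))    ≈⟨ ψ-0 α _ x^3K≈0 ⟩
      1#                     ∎

    ∑χ-3* : ∀ {x K} → 3 ∣ K → HasOrder x (3 *ℕ K) → ∀ α →
            ∑ (map (χ α x) (G¹ (3 *ℕ K))) ≈ Φ₃ (ψ α x ^ K) * ∑ (map (χ α x) (G¹ K))
    ∑χ-3* {x} {K} 3∣K hasOrder α = begin
      ∑ (map (χ α x) (G¹ (3 *ℕ K)))                   ≈⟨ ∑χ≈ α x (G¹ (3 *ℕ K)) ⟩
      ∑ (map (c ^_) (G¹ (3 *ℕ K))) - ∑ (map (d ^_) (G¹ (3 *ℕ K))) ≈⟨ +-cong (∑-^-G¹-3* 3∣K c) (-‿cong (∑-^-G¹-3* 3∣K d)) ⟩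
      Φ₃ (c ^ K) * A - Φ₃ (d ^ K) * B                 ≈⟨ +-congˡ (-‿cong (*-congʳ (Φ₃-inverse (ψ^K-cube≈1 {x} {K} hasOrder α) dᴷcᴷ≈1))) ⟩
      Φ₃ (c ^ K) * A - Φ₃ (c ^ K) * B                 ≈⟨ x[y-z]≈xy-xz (Φ₃ (c ^ K)) A B ⟨
      Φ₃ (c ^ K) * (A - B)                            ≈⟨ *-congˡ (∑χ≈ α x (G¹ K)) ⟨
      Φ₃ (c ^ K) * ∑ (map (χ α x) (G¹ K))             ∎
      where
        c d A B : Carrier
        c = ψ α x
        d = ψ α (-Γ x)
        A = ∑ (map (c ^_) (G¹ K))
        B = ∑ (map (d ^_) (G¹ K))
        dᴷcᴷ≈1 : d ^ K * c ^ K ≈ 1#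
        dᴷcᴷ≈1 = begin
          d ^ K * c ^ K    ≈⟨ ^-distrib-* d c K ⟨
          (d * c) ^ K      ≈⟨ ^-congˡ K (ψ-inverse α x) ⟩
          1# ^ K           ≈⟨ 1^n≈1 K ⟩
          1#               ∎

    T-evaluation : (∀ a b → a * b ≈ 0# → a ≈ 0# ⊎ b ≈ 0#) →
                   ∀ {x K} → 3 ∣ K → HasOrder x (3 *ℕ K) → ∀ α →
                   (ψ α (x ^Γ K) ≈ 1# → T x (3 *ℕ K) α ≈ (ℕ→R R 3 * i√3) * ∑ (map (χ α x) (G¹ K)))
                   × (¬ ψ α (x ^Γ K) ≈ 1# → T x (3 *ℕ K) α ≈ 0#)
    T-evaluation noZeroDivisors {x} {K} 3∣K hasOrder α = trivial , nontrivial
      where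
        u S : Carrier
        u = ψ α x ^ K
        S = ∑ (map (χ α x) (G¹ K))
        T≈ : T x (3 *ℕ K) α ≈ i√3 * (Φ₃ u * S)
        T≈ = trans (T≈i√3∑χ hasOrder α) (*-congˡ (∑χ-3* 3∣K hasOrder α))
        ψxᴷ≈u : ψ α (x ^Γ K) ≈ u
        ψxᴷ≈u = ψ-^Γ α x K
        trivial : ψ α (x ^Γ K) ≈ 1# → T x (3 *ℕ K) α ≈ (ℕ→R R 3 * i√3) * S
        trivial ψxᴷ≈1 = begin
          T x (3 *ℕ K) α           ≈⟨ T≈ ⟩
          i√3 * (Φ₃ u * S)         ≈⟨ *-congˡ (*-congʳ (Φ₃≈3 (trans (sym ψxᴷ≈u) ψxᴷ≈1))) ⟩
          i√3 * (ℕ→R R 3 * S)      ≈⟨ *-assoc i√3 _ S ⟨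
          (i√3 * ℕ→R R 3) * S      ≈⟨ *-congʳ (*-comm i√3 _) ⟩
          (ℕ→R R 3 * i√3) * S      ∎
        nontrivial : ¬ ψ α (x ^Γ K) ≈ 1# → T x (3 *ℕ K) α ≈ 0#
        nontrivial ψxᴷ≉1 = begin
          T x (3 *ℕ K) α           ≈⟨ T≈ ⟩
          i√3 * (Φ₃ u * S)         ≈⟨ *-congˡ (*-congʳ (Φ₃≈0 noZeroDivisors (ψ^K-cube≈1 {x} {K} hasOrder α) (ψxᴷ≉1 ∘ trans ψxᴷ≈u))) ⟩
          i√3 * (0# * S)           ≈⟨ *-congˡ (zeroˡ S) ⟩
          i√3 * 0#                 ≈⟨ zeroʳ i√3 ⟩
          0#                       ∎

open import Data.Nat using (_*_; _^_; _∸_)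

m*n/m≡n : ∀ m .{{_ : NonZero m}} n → m * n / m ≡ n
m*n/m≡n m n = ≡.trans (≡.cong (_/ m) (ℕP.*-comm m n)) (m*n/n≡m n m)

lemma5p4 : ∀ {c ℓ : Level} (R : CommutativeRing c ℓ) (ζ : CommutativeRing.Carrier R) (L : ℕ)
  → (∀ a b → CommutativeRing._≈_ R (CommutativeRing._*_ R a b) (CommutativeRing.0# R)
       → CommutativeRing._≈_ R a (CommutativeRing.0# R) ⊎ CommutativeRing._≈_ R b (CommutativeRing.0# R))
  → (∀ n → CommutativeRing._≈_ R (ℕ→R R n) (CommutativeRing.0# R) → n ≡ 0)
  → 0 < L
  → CommutativeRing._≈_ R (powR R ζ L) (CommutativeRing.1# R)
  → (∀ d → 0 < d → d < L → ¬ CommutativeRing._≈_ R (powR R ζ d) (CommutativeRing.1# R))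
  → 3 ∣ L
  → ∀ {k : ℕ} (m : Fin k → ℕ)
  → (∀ j → Group.n m j ∣ L)
  → (x : Group.Γ m) (t mm : ℕ)
  → Group.HasOrder m x ((3 ^ t) * mm)
  → ¬ (3 ∣ mm)
  → 2 ≤ t
  → (α : Group.Γ m)
  → (CommutativeRing._≈_ R
        (Chars.ψ R ζ L m α (Group._^Γ_ m x (((3 ^ t) * mm) / 3)))
        (CommutativeRing.1# R)
      → CommutativeRing._≈_ R
          (Chars.T R ζ L m x ((3 ^ t) * mm) α)
          (CommutativeRing._*_ R
            (CommutativeRing._*_ R (ℕ→R R 3) (Chars.i√3 R ζ L m))
            (Chars.ΣR R ζ L m
              (map
                (λ r → CommutativeRing._-_ R
                  (Chars.ψ R ζ L m α (Group._^Γ_ m x r))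
                  (Chars.ψ R ζ L m α (Group.-Γ_ m (Group._^Γ_ m x r))))
                (G¹ ((3 ^ (t ∸ 1)) * mm))))))
    × (¬ CommutativeRing._≈_ R
           (Chars.ψ R ζ L m α (Group._^Γ_ m x (((3 ^ t) * mm) / 3)))
           (CommutativeRing.1# R)
      → CommutativeRing._≈_ R (Chars.T R ζ L m x ((3 ^ t) * mm) α) (CommutativeRing.0# R))
lemma5p4 R ζ L noZeroDivisors _ _ ζ^L≈1 _ _ m n∣L x (suc (suc t)) mm hasOrder _ (s≤s (s≤s z≤n)) α
  rewrite ℕP.*-assoc 3 (3 ^ suc t) mm | m*n/m≡n 3 (3 ^ suc t * mm)
  = Characters.T-evaluation R ζ L ζ^L≈1 m n∣L noZeroDivisors (∣-trans (m∣m*n (3 ^ t)) (m∣m*n mm)) hasOrder α
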